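{- Let $p=(123,\{2\},\emptyset)$ and $r=(312,\emptyset,\{2\})$. Then for every $n\ge 1$, $|\mathrm{Av}_n(p,r)|=2^{n-1}$.
   Context: For $n\ge 0$, $\mathcal{S}_n$ is the set of permutations of $[n]=\{1,\dots,n\}$, written as words $\pi=\pi(1)\pi(2)\cdots\pi(n)$. Two words of distinct integers of the same length are order-isomorphic if their entries appear in the same relative order. A pattern of length 3 is a triple $(\sigma,X,Y)$ with $\sigma\in\mathcal{S}_3$ and $X,Y\subseteq\{1,2\}$. A permutation $\pi\in\mathcal{S}_n$ contains $(\sigma,X,Y)$ if there are indices $i_1<i_2<i_3$ such that $\pi(i_1)\pi(i_2)\pi(i_3)$ is order-isomorphic to $\sigma$, $i_{x+1}=i_x+1$ for every $x\in X$, and $j_{y+1}=j_y+1$ for every $y\in Y$, where $j_1<j_2<j_3$ are the three values $\pi(i_1),\pi(i_2),\pi(i_3)$ listed in increasing order; otherwise $\pi$ avoids it. For patterns $P_1,\dots,P_m$, $\mathrm{Av}_n(P_1,\dots,P_m)$ is the set of $\pi\in\mathcal{S}_n$ avoiding every $P_i$. -}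

module Defs where

open import Data.Nat using (ℕ; suc; _≤_; _^_; _∸_)
open import Data.Fin using (Fin; zero; suc; toℕ; inject₁) renaming (_<_ to _<ᶠ_)
open import Data.Vec using (Vec; []; _∷_; lookup; toList)
open import Data.List using (List; []; _∷_; length)
open import Data.List.Membership.Propositional using (_∈_)
open import Data.List.Relation.Unary.Unique.Propositional using (Unique)
open import Data.Product using (Σ; _×_; ∃)
open import Relation.Binary.PropositionalEquality using (_≡_)
open import Relation.Nullary using (¬_)
open import Function.Bundles using (_⇔_)

-- A word π(1)…π(n) is a Vec of length n; value k ∈ [n] is encoded as
-- the element k-1 of Fin n (order is preserved, so order-isomorphism is
-- unaffected).
IsPerm : {n : ℕ} → Vec (Fin n) n → Set
IsPerm π = Unique (toList π)

-- A pattern of length 3: σ ∈ S₃ (as a word over Fin 3, value k encoded as k-1),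
-- and X, Y ⊆ {1,2}, encoded as lists over Fin 2 (element x encodes x+1).
record Pattern : Set where
  constructor pat
  field
    σ : Vec (Fin 3) 3
    X : List (Fin 2)
    Y : List (Fin 2)

-- Occurrence: positions ι(0) < ι(1) < ι(2) (0-based for i₁<i₂<i₃).
Contains : {n : ℕ} → Vec (Fin n) n → Pattern → Set
Contains {n} π (pat σ X Y) =
  Σ (Fin 3 → Fin n) λ ι →
    (∀ a b → a <ᶠ b → ι a <ᶠ ι b)
    × (∀ a b → (lookup σ a <ᶠ lookup σ b) ⇔ (lookup π (ι a) <ᶠ lookup π (ι b)))
    × (∀ x → x ∈ X → toℕ (ι (suc x)) ≡ suc (toℕ (ι (inject₁ x))))
    -- j_{y+1} = j_y + 1 for y ∈ Y, where j_k is the k-th smallest of the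
    -- three values, i.e. the value at the position a with σ(a) = k
    × (∀ y → y ∈ Y → ∀ a b → lookup σ a ≡ inject₁ y → lookup σ b ≡ suc y →
         toℕ (lookup π (ι b)) ≡ suc (toℕ (lookup π (ι a))))

Avoids : {n : ℕ} → Vec (Fin n) n → Pattern → Set
Avoids π P = ¬ Contains π P

InAv₂ : (n : ℕ) → Pattern → Pattern → Vec (Fin n) n → Set
InAv₂ n p r π = IsPerm π × Avoids π p × Avoids π r

p : Pattern
p = pat (zero ∷ suc zero ∷ suc (suc zero) ∷ []) (suc zero ∷ []) []

r : Pattern
r = pat (suc (suc zero) ∷ zero ∷ suc zero ∷ []) [] (suc zero ∷ [])

HasCard : {A : Set} → (A → Set) → ℕ → Set
HasCard {A} P k = Σ (List A) λ L → Unique L × (∀ a → (a ∈ L) ⇔ P a) × length L ≡ k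

-- Deleting the last entry of an avoider of length n + 2 and standardising the rest gives an
-- avoider of length n + 1.  Conversely, an avoider τ extends by appending a last value x (and
-- shifting the entries ≥ x up) exactly when x = 0, or x is one less than the new penultimate
-- value y, or y = 0 and x is the maximum; any other ending produces an occurrence of p or r,
-- located with the help of the values 0 and x + 1.  Each τ thus has exactly two extensions,
-- so the avoiders of length n + 1 form an explicit list of 2^n distinct permutations.

module Submission where

open import Defs
open import Data.Empty using (⊥-elim)
open import Data.Fin using (Fin; zero; suc; toℕ; inject₁; fromℕ; fromℕ<; lower₁; punchIn; punchOut; _≟_)
import Data.Fin.Properties as Fin
open import Data.Fin.Properties
  using (toℕ-injective; toℕ<n; toℕ-fromℕ; toℕ-fromℕ<; toℕ-inject₁; inject₁-injective; inject₁ℕ<; inject₁ℕ≤;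
         inject₁-lower₁; fromℕ≢inject₁; punchIn-injective; punchInᵢ≢i; punchIn-punchOut; punchOut-injective;
         0≢1+n; injective⇒≤; any?)
open import Data.List as List using (List; length; _++_)
open import Data.List.Membership.Propositional using (_∈_)
open import Data.List.Membership.Propositional.Properties using (∈-map⁺; ∈-map⁻; ∈-++⁺ˡ; ∈-++⁺ʳ; ∈-++⁻)
open import Data.List.Properties using (length-map; length-++)
open import Data.List.Relation.Unary.All using (All)
open import Data.List.Relation.Unary.AllPairs using (AllPairs)
open import Data.List.Relation.Unary.Any using (here)
open import Data.List.Relation.Unary.Unique.Propositional using (Unique)
import Data.List.Relation.Unary.Unique.Propositional.Properties as Unique
open import Data.Nat using (ℕ; zero; suc; _≤_; _<_; _^_; _∸_; _+_; s≤s; z<s; s<s)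
import Data.Nat.Properties as Nat
open import Data.Nat.Properties
  using (<-irrefl; <-asym; <-trans; ≤-trans; ≤-reflexive; <-cmp; ≤-pred; ≤∧≢⇒<; ≮⇒≥; n≢0⇒n>0; n<1+n;
         1+n≰n; 1+n≢n; +-identityʳ)
  renaming (_≟_ to _≟ℕ_; _<?_ to _<?ℕ_)
open import Data.Product using (_×_; _,_; proj₁; proj₂; ∃; ∃₂)
open import Data.Sum using (_⊎_; inj₁; inj₂)
open import Data.Vec using (Vec; []; _∷_; lookup; toList; map; _∷ʳ_; initLast)
import Data.Vec.Relation.Unary.All.Properties as VecAll
open import Data.Vec.Properties using (∷-injective; ∷ʳ-injective; lookup-map)
open import Function using (_∘_; _$_)
open import Function.Bundles using (Equivalence; mk⇔; _⇔_)
open import Function.Definitions using (Injective)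
import Function.Properties.Equivalence as ⇔
open import Relation.Binary.Definitions using (tri<; tri≈; tri>)
open import Relation.Binary.PropositionalEquality
  using (_≡_; _≢_; refl; sym; trans; cong; cong₂; subst; subst₂; module ≡-Reasoning)
open import Relation.Nullary using (¬_; yes; no)
open import Relation.Nullary.Decidable using (_×-dec_)

record P-Occurrence {m : ℕ} (f : Fin m → ℕ) : Set where
  constructor mkP
  field
    i j k   : Fin m
    i<j     : toℕ i < toℕ j
    k≡1+j   : toℕ k ≡ suc (toℕ j)
    fi<fj   : f i < f j
    fj<fk   : f j < f k

record R-Occurrence {m : ℕ} (f : Fin m → ℕ) : Set where
  constructor mkR
  field
    i j k   : Fin m
    i<j     : toℕ i < toℕ j
    j<k     : toℕ j < toℕ k
    fj<fk   : f j < f k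
    fi≡1+fk : f i ≡ suc (f k)

values : ∀ {m} → Vec (Fin m) m → Fin m → ℕ
values π = toℕ ∘ lookup π

triple : {A : Set} → A → A → A → Fin 3 → A
triple x y z zero             = x
triple x y z (suc zero)       = y
triple x y z (suc (suc zero)) = z

triple-increasing : ∀ {m} {i j k : Fin m} → toℕ i < toℕ j → toℕ j < toℕ k →
                    ∀ a b → toℕ a < toℕ b → toℕ (triple i j k a) < toℕ (triple i j k b)
triple-increasing i<j j<k zero             (suc zero)       _ = i<j
triple-increasing i<j j<k zero             (suc (suc zero)) _ = <-trans i<j j<k
triple-increasing i<j j<k (suc zero)       (suc (suc zero)) _ = j<k
triple-increasing i<j j<k (suc zero)       (suc zero)       (s≤s ())
triple-increasing i<j j<k (suc (suc zero)) (suc zero)       (s≤s ())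
triple-increasing i<j j<k (suc (suc zero)) (suc (suc zero)) (s≤s (s≤s ()))

module _ {m : ℕ} (π : Vec (Fin m) m) where

  contains-p⇔ : Contains π p ⇔ P-Occurrence (values π)
  contains-p⇔ = mk⇔ to from
    where
    to : Contains π p → P-Occurrence (values π)
    to (ι , ι-increasing , iso , adjacent , _) =
      mkP (ι zero) (ι (suc zero)) (ι (suc (suc zero)))
          (ι-increasing zero (suc zero) z<s) (adjacent (suc zero) (here refl))
          (Equivalence.to (iso zero (suc zero)) z<s)
          (Equivalence.to (iso (suc zero) (suc (suc zero))) (s<s z<s))

    from : P-Occurrence (values π) → Contains π p
    from (mkP i j k i<j k≡1+j fi<fj fj<fk) =
      triple i j k , triple-increasing i<j j<k , iso , adjacent , λ _ ()
      where
      j<k = ≤-reflexive (sym k≡1+j)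
      f = values π
      iso : ∀ a b → (toℕ (lookup (Pattern.σ p) a) < toℕ (lookup (Pattern.σ p) b))
                  ⇔ (f (triple i j k a) < f (triple i j k b))
      iso zero             zero             = mk⇔ (λ ()) (⊥-elim ∘ <-irrefl refl)
      iso zero             (suc zero)       = mk⇔ (λ _ → fi<fj) (λ _ → z<s)
      iso zero             (suc (suc zero)) = mk⇔ (λ _ → <-trans fi<fj fj<fk) (λ _ → z<s)
      iso (suc zero)       zero             = mk⇔ (λ ()) (λ fj<fi → ⊥-elim (<-asym fj<fi fi<fj))
      iso (suc zero)       (suc zero)       = mk⇔ (λ { (s≤s ()) }) (⊥-elim ∘ <-irrefl refl)
      iso (suc zero)       (suc (suc zero)) = mk⇔ (λ _ → fj<fk) (λ _ → s<s z<s)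
      iso (suc (suc zero)) zero             = mk⇔ (λ ()) (λ fk<fi → ⊥-elim (<-asym fk<fi (<-trans fi<fj fj<fk)))
      iso (suc (suc zero)) (suc zero)       = mk⇔ (λ { (s≤s ()) }) (λ fk<fj → ⊥-elim (<-asym fk<fj fj<fk))
      iso (suc (suc zero)) (suc (suc zero)) = mk⇔ (λ { (s≤s (s≤s ())) }) (⊥-elim ∘ <-irrefl refl)
      adjacent : ∀ x → x ∈ Pattern.X p → toℕ (triple i j k (suc x)) ≡ suc (toℕ (triple i j k (inject₁ x)))
      adjacent _ (here refl) = k≡1+j

  contains-r⇔ : Contains π r ⇔ R-Occurrence (values π)
  contains-r⇔ = mk⇔ to from
    where
    to : Contains π r → R-Occurrence (values π)
    to (ι , ι-increasing , iso , _ , adjacent) =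
      mkR (ι zero) (ι (suc zero)) (ι (suc (suc zero)))
          (ι-increasing zero (suc zero) z<s) (ι-increasing (suc zero) (suc (suc zero)) (s<s z<s))
          (Equivalence.to (iso (suc zero) (suc (suc zero))) z<s)
          (adjacent (suc zero) (here refl) (suc (suc zero)) zero refl refl)

    from : R-Occurrence (values π) → Contains π r
    from (mkR i j k i<j j<k fj<fk fi≡1+fk) =
      triple i j k , triple-increasing i<j j<k , iso , (λ _ ()) , adjacent
      where
      f = values π
      fk<fi = ≤-reflexive (sym fi≡1+fk)
      fj<fi = <-trans fj<fk fk<fi
      iso : ∀ a b → (toℕ (lookup (Pattern.σ r) a) < toℕ (lookup (Pattern.σ r) b))
                  ⇔ (f (triple i j k a) < f (triple i j k b))
      iso zero             zero             = mk⇔ (λ { (s≤s (s≤s ())) }) (⊥-elim ∘ <-irrefl refl)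
      iso zero             (suc zero)       = mk⇔ (λ ()) (λ fi<fj → ⊥-elim (<-asym fi<fj fj<fi))
      iso zero             (suc (suc zero)) = mk⇔ (λ { (s≤s ()) }) (λ fi<fk → ⊥-elim (<-asym fi<fk fk<fi))
      iso (suc zero)       zero             = mk⇔ (λ _ → fj<fi) (λ _ → z<s)
      iso (suc zero)       (suc zero)       = mk⇔ (λ ()) (⊥-elim ∘ <-irrefl refl)
      iso (suc zero)       (suc (suc zero)) = mk⇔ (λ _ → fj<fk) (λ _ → z<s)
      iso (suc (suc zero)) zero             = mk⇔ (λ _ → fk<fi) (λ _ → s<s z<s)
      iso (suc (suc zero)) (suc zero)       = mk⇔ (λ ()) (λ fk<fj → ⊥-elim (<-asym fk<fj fj<fk))
      iso (suc (suc zero)) (suc (suc zero)) = mk⇔ (λ { (s≤s ()) }) (⊥-elim ∘ <-irrefl refl)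
      adjacent : ∀ y → y ∈ Pattern.Y r → ∀ a b → lookup (Pattern.σ r) a ≡ inject₁ y →
                 lookup (Pattern.σ r) b ≡ suc y → f (triple i j k b) ≡ suc (f (triple i j k a))
      adjacent _ (here refl) (suc (suc zero)) zero             refl refl = fi≡1+fk
      adjacent _ (here refl) zero             _                ()   _
      adjacent _ (here refl) (suc zero)       _                ()   _
      adjacent _ (here refl) (suc (suc zero)) (suc zero)       _    ()
      adjacent _ (here refl) (suc (suc zero)) (suc (suc zero)) _    ()

P-transfer : ∀ {m} {f g : Fin m → ℕ} → (∀ {a b} → f a < f b → g a < g b) →
             P-Occurrence f → P-Occurrence g
P-transfer mono (mkP i j k i<j k≡1+j fi<fj fj<fk) = mkP i j k i<j k≡1+j (mono fi<fj) (mono fj<fk)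

R-transfer : ∀ {m} {f g : Fin m → ℕ} → (∀ {a b} → f a < f b → g a < g b) →
             (∀ {a b} → f a ≡ suc (f b) → g a ≡ suc (g b)) → R-Occurrence f → R-Occurrence g
R-transfer mono adj (mkR i j k i<j j<k fj<fk fi≡1+fk) = mkR i j k i<j j<k (mono fj<fk) (adj fi≡1+fk)

final : ∀ {m} → Fin (suc m)
final {m} = fromℕ m

penultimate : ∀ {m} → Fin (suc (suc m))
penultimate = inject₁ final

toℕ-final : ∀ {m} → toℕ (final {m}) ≡ m
toℕ-final {m} = toℕ-fromℕ m

toℕ-penultimate : ∀ {m} → toℕ (penultimate {m}) ≡ m
toℕ-penultimate = trans (toℕ-inject₁ final) toℕ-final

final≡1+penultimate : ∀ {m} → toℕ (final {suc m}) ≡ suc (toℕ (penultimate {m}))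
final≡1+penultimate = trans toℕ-final (cong suc (sym toℕ-penultimate))

penultimate<final : ∀ {m} → toℕ (penultimate {m}) < toℕ (final {suc m})
penultimate<final = ≤-reflexive (sym final≡1+penultimate)

module _ {m : ℕ} (_∼_ : ℕ → ℕ → Set) {a b : Fin m} where

  inject₁⁺ : toℕ a ∼ toℕ b → toℕ (inject₁ a) ∼ toℕ (inject₁ b)
  inject₁⁺ = subst₂ _∼_ (sym (toℕ-inject₁ a)) (sym (toℕ-inject₁ b))

  inject₁⁻ : toℕ (inject₁ a) ∼ toℕ (inject₁ b) → toℕ a ∼ toℕ b
  inject₁⁻ = subst₂ _∼_ (toℕ-inject₁ a) (toℕ-inject₁ b)

≢final⇒< : ∀ {m} {a : Fin (suc m)} → a ≢ final → toℕ a < m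
≢final⇒< {a = a} a≢final = ≤∧≢⇒< (≤-pred (toℕ<n a)) (λ a≡m → a≢final (toℕ-injective (trans a≡m (sym toℕ-final))))

below-final : ∀ {m} (a : Fin (suc m)) → toℕ a < m → ∃ λ a′ → a ≡ inject₁ a′
below-final a a<m = lower₁ a m≢a , sym (inject₁-lower₁ a m≢a)
  where m≢a = λ m≡a → <-irrefl (sym m≡a) a<m

final-or-inject₁ : ∀ {m} (a : Fin (suc m)) → a ≡ final ⊎ ∃ λ a′ → a ≡ inject₁ a′
final-or-inject₁ a with a ≟ final
... | yes a≡final = inj₁ a≡final
... | no  a≢final = inj₂ (below-final a (≢final⇒< a≢final))

before-penultimate : ∀ {m} {a : Fin (suc (suc m))} → a ≢ final → a ≢ penultimate →
                     toℕ a < toℕ (penultimate {m})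
before-penultimate {a = a} a≢final a≢penultimate with below-final a (≢final⇒< a≢final)
... | a′ , refl = inject₁⁺ _<_ (subst (toℕ a′ <_) (sym toℕ-final) (≢final⇒< (a≢penultimate ∘ cong inject₁)))

module _ {m : ℕ} {f : Fin (suc m) → ℕ} where

  P-inject₁ : P-Occurrence (f ∘ inject₁) → P-Occurrence f
  P-inject₁ (mkP i j k i<j k≡1+j fi<fj fj<fk) =
    mkP (inject₁ i) (inject₁ j) (inject₁ k) (inject₁⁺ _<_ i<j) (inject₁⁺ (λ x y → x ≡ suc y) k≡1+j) fi<fj fj<fk

  R-inject₁ : R-Occurrence (f ∘ inject₁) → R-Occurrence f
  R-inject₁ (mkR i j k i<j j<k fj<fk fi≡1+fk) =
    mkR (inject₁ i) (inject₁ j) (inject₁ k) (inject₁⁺ _<_ i<j) (inject₁⁺ _<_ j<k) fj<fk fi≡1+fk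

  P-final-or-prefix : (o : P-Occurrence f) → P-Occurrence.k o ≡ final ⊎ P-Occurrence (f ∘ inject₁)
  P-final-or-prefix (mkP i j k i<j k≡1+j fi<fj fj<fk) with final-or-inject₁ k
  ... | inj₁ k≡final = inj₁ k≡final
  ... | inj₂ (k′ , refl) with below-final j j<m | below-final i (<-trans i<j j<m)
    where j<m = ≤-trans (≤-reflexive (sym k≡1+j)) (inject₁ℕ≤ k′)
  ...   | j′ , refl | i′ , refl =
    inj₂ (mkP i′ j′ k′ (inject₁⁻ _<_ i<j) (inject₁⁻ (λ x y → x ≡ suc y) k≡1+j) fi<fj fj<fk)

  R-final-or-prefix : (o : R-Occurrence f) → R-Occurrence.k o ≡ final ⊎ R-Occurrence (f ∘ inject₁)
  R-final-or-prefix (mkR i j k i<j j<k fj<fk fi≡1+fk) with final-or-inject₁ k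
  ... | inj₁ k≡final = inj₁ k≡final
  ... | inj₂ (k′ , refl) with below-final j j<m | below-final i (<-trans i<j j<m)
    where j<m = <-trans j<k (inject₁ℕ< k′)
  ...   | j′ , refl | i′ , refl =
    inj₂ (mkR i′ j′ k′ (inject₁⁻ _<_ i<j) (inject₁⁻ _<_ j<k) fj<fk fi≡1+fk)

unique⇔injective : ∀ {A : Set} {m} (xs : Vec A m) → Unique (toList xs) ⇔ Injective _≡_ _≡_ (lookup xs)
unique⇔injective xs = mk⇔ (to xs) (from xs)
  where
  to : ∀ {A : Set} {m} (xs : Vec A m) → Unique (toList xs) → Injective _≡_ _≡_ (lookup xs)
  to (x ∷ xs) _                   {zero}  {zero}  _  = refl
  to (x ∷ xs) (x∉ AllPairs.∷ _)   {zero}  {suc b} eq = ⊥-elim (VecAll.lookup⁺ (VecAll.toList⁻ x∉) b eq)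
  to (x ∷ xs) (x∉ AllPairs.∷ _)   {suc a} {zero}  eq = ⊥-elim (VecAll.lookup⁺ (VecAll.toList⁻ x∉) a (sym eq))
  to (x ∷ xs) (_ AllPairs.∷ uniq) {suc a} {suc b} eq = cong suc (to xs uniq eq)

  from : ∀ {A : Set} {m} (xs : Vec A m) → Injective _≡_ _≡_ (lookup xs) → Unique (toList xs)
  from []       _   = AllPairs.[]
  from (x ∷ xs) inj =
    VecAll.toList⁺ (VecAll.lookup⁻ (λ _ → 0≢1+n ∘ inj)) AllPairs.∷ from xs (Fin.suc-injective ∘ inj)

injective⇒surjective : ∀ {m} {g : Fin m → Fin m} → Injective _≡_ _≡_ g → ∀ w → ∃ λ a → g a ≡ w
injective⇒surjective {suc m} {g} g-inj w with any? (λ a → g a ≟ w)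
... | yes hit = hit
... | no  miss = ⊥-elim (1+n≰n (injective⇒≤ {f = g′} g′-injective))
  where
  w≢g : ∀ a → w ≢ g a
  w≢g a w≡ga = miss (a , sym w≡ga)
  g′ : Fin (suc m) → Fin m
  g′ a = punchOut (w≢g a)
  g′-injective : Injective _≡_ _≡_ g′
  g′-injective = g-inj ∘ punchOut-injective (w≢g _) (w≢g _)

Avoider : ∀ {m} → Vec (Fin m) m → Set
Avoider π = Injective _≡_ _≡_ (lookup π) × ¬ P-Occurrence (values π) × ¬ R-Occurrence (values π)

inAv₂⇔avoider : ∀ {m} (π : Vec (Fin m) m) → InAv₂ m p r π ⇔ Avoider π
inAv₂⇔avoider π = mk⇔
  (λ (uniq , ¬p , ¬r) → to (unique⇔injective π) uniq , ¬p ∘ from (contains-p⇔ π) , ¬r ∘ from (contains-r⇔ π))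
  (λ (inj , ¬p , ¬r) → from (unique⇔injective π) inj , ¬p ∘ to (contains-p⇔ π) , ¬r ∘ to (contains-r⇔ π))
  where open Equivalence

punchInℕ : ℕ → ℕ → ℕ
punchInℕ zero    x       = suc x
punchInℕ (suc v) zero    = zero
punchInℕ (suc v) (suc x) = suc (punchInℕ v x)

toℕ-punchIn : ∀ {m} (v : Fin (suc m)) (j : Fin m) → toℕ (punchIn v j) ≡ punchInℕ (toℕ v) (toℕ j)
toℕ-punchIn zero    j       = refl
toℕ-punchIn (suc v) zero    = refl
toℕ-punchIn (suc v) (suc j) = cong suc (toℕ-punchIn v j)

punchInℕ-mono-< : ∀ v {x y} → x < y → punchInℕ v x < punchInℕ v y
punchInℕ-mono-< zero                    x<y       = s<s x<y
punchInℕ-mono-< (suc v) {zero}  {suc y} _         = z<s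
punchInℕ-mono-< (suc v) {suc x} {suc y} (s<s x<y) = s<s (punchInℕ-mono-< v x<y)

punchInℕ-cancel-< : ∀ v {x y} → punchInℕ v x < punchInℕ v y → x < y
punchInℕ-cancel-< zero                    (s<s x<y) = x<y
punchInℕ-cancel-< (suc v) {zero}  {suc y} _         = z<s
punchInℕ-cancel-< (suc v) {suc x} {suc y} (s<s lt)  = s<s (punchInℕ-cancel-< v lt)

punchInℕ≡0 : ∀ v {x} → punchInℕ v x ≡ 0 → x ≡ 0
punchInℕ≡0 (suc v) {zero} _ = refl

punchInℕ-cancel-suc : ∀ v {x y} → punchInℕ v x ≡ suc (punchInℕ v y) → x ≡ suc y
punchInℕ-cancel-suc zero                    eq = Nat.suc-injective eq
punchInℕ-cancel-suc (suc v) {suc x} {zero}  eq = cong suc (punchInℕ≡0 v (Nat.suc-injective eq))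
punchInℕ-cancel-suc (suc v) {suc x} {suc y} eq = cong suc (punchInℕ-cancel-suc v (Nat.suc-injective eq))

punchInℕ≡1+v : ∀ v {x} → punchInℕ v x ≡ suc v → x ≡ v
punchInℕ≡1+v zero            eq = Nat.suc-injective eq
punchInℕ≡1+v (suc v) {suc x} eq = cong suc (punchInℕ≡1+v v (Nat.suc-injective eq))

punchInℕ-< : ∀ {v x} → x < v → punchInℕ v x ≡ x
punchInℕ-< {suc v} {zero}  _         = refl
punchInℕ-< {suc v} {suc x} (s<s x<v) = cong suc (punchInℕ-< x<v)

punchInℕ-≥ : ∀ {v x} → v ≤ x → punchInℕ v x ≡ suc x
punchInℕ-≥ {zero}          _         = refl
punchInℕ-≥ {suc v} {suc x} (s≤s v≤x) = cong suc (punchInℕ-≥ v≤x)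

punchInℕ-suc : ∀ v y → punchInℕ v (suc y) ≡ suc (punchInℕ v y) ⊎ v ≡ suc y
punchInℕ-suc zero          y       = inj₁ refl
punchInℕ-suc (suc zero)    zero    = inj₂ refl
punchInℕ-suc (suc (suc v)) zero    = inj₁ refl
punchInℕ-suc (suc v)       (suc y) with punchInℕ-suc v y
... | inj₁ eq = inj₁ (cong suc eq)
... | inj₂ eq = inj₂ (cong suc eq)

Admissible : ℕ → ℕ → ℕ → Set
Admissible n x y = x ≡ 0 ⊎ y ≡ suc x ⊎ (y ≡ 0 × x ≡ suc n)

AdmissibleEnding : ∀ {n} → (Fin (suc (suc n)) → ℕ) → Set
AdmissibleEnding {n} f = Admissible n (f final) (f penultimate)

module _ {n : ℕ} {f : Fin (suc (suc n)) → ℕ} where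

  P-admissible : AdmissibleEnding f → P-Occurrence f → P-Occurrence (f ∘ inject₁)
  P-admissible ending o@(mkP i j k i<j k≡1+j fi<fj fj<fk) with P-final-or-prefix o
  ... | inj₂ o′   = o′
  ... | inj₁ refl with toℕ-injective {i = j} {j = penultimate}
                         (Nat.suc-injective (trans (sym k≡1+j) final≡1+penultimate))
  ...   | refl with ending
  ...     | inj₁ x≡0              = ⊥-elim $ Nat.n≮0 (subst (f j <_) x≡0 fj<fk)
  ...     | inj₂ (inj₁ y≡1+x)     = ⊥-elim $ <-asym fj<fk (subst (f final <_) (sym y≡1+x) (n<1+n _))
  ...     | inj₂ (inj₂ (y≡0 , _)) = ⊥-elim $ Nat.n≮0 (subst (f i <_) y≡0 fi<fj)

  R-admissible : Injective _≡_ _≡_ f → (∀ a → f a < suc (suc n)) → AdmissibleEnding f →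
                 R-Occurrence f → R-Occurrence (f ∘ inject₁)
  R-admissible f-inj f-bounded ending o@(mkR i j k i<j j<k fj<fk fi≡1+fk) with R-final-or-prefix o
  ... | inj₂ o′   = o′
  ... | inj₁ refl with ending
  ...   | inj₁ x≡0                = ⊥-elim $ Nat.n≮0 (subst (f j <_) x≡0 fj<fk)
  ...   | inj₂ (inj₂ (_ , x≡1+n)) =
    ⊥-elim $ <-irrefl refl (subst (_< suc (suc n)) (trans fi≡1+fk (cong suc x≡1+n)) (f-bounded i))
  ...   | inj₂ (inj₁ y≡1+x) with f-inj (trans fi≡1+fk (sym y≡1+x))
  ...     | refl = ⊥-elim $ <-irrefl refl (Nat.<-≤-trans i<j (≤-pred (subst (toℕ j <_) final≡1+penultimate j<k)))

module _ {n : ℕ} {g : Fin (suc (suc n)) → Fin (suc (suc n))} (g-inj : Injective _≡_ _≡_ g)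
         (¬p : ¬ P-Occurrence (toℕ ∘ g)) (¬r : ¬ R-Occurrence (toℕ ∘ g)) where

  private
    f : Fin (suc (suc n)) → ℕ
    f = toℕ ∘ g

    x = f final
    y = f penultimate

    position-of : ∀ v → v < suc (suc n) → ∃ λ a → f a ≡ v
    position-of v v<2+n with injective⇒surjective g-inj (fromℕ< v<2+n)
    ... | a , ga≡v = a , trans (cong toℕ ga≡v) (toℕ-fromℕ< v<2+n)

    -- The value x + 1, placed before the penultimate position, is followed by a value below x:
    -- otherwise the position of 0, which then lies before it, starts an occurrence of p.
    dip-after : x ≢ 0 → ∀ {a} → f a ≡ suc x → toℕ a < toℕ (penultimate {n}) →
                ∃ λ b → toℕ a < toℕ b × toℕ b < suc n × f b < x
    dip-after x≢0 {a} fa≡1+x a<penultimate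
      with any? (λ b → (toℕ a <?ℕ toℕ b) ×-dec (toℕ b <?ℕ suc n) ×-dec (f b <?ℕ x))
    ... | yes dip = dip
    ... | no  no-dip with position-of 0 z<s
    ...   | z , fz≡0 =
      ⊥-elim $ ¬p (mkP z a a⁺ z<a (toℕ-fromℕ< a⁺<2+n) (subst₂ _<_ (sym fz≡0) (sym fa≡1+x) z<s) fa<fa⁺)
      where
      a<n : toℕ a < n
      a<n = subst (toℕ a <_) toℕ-penultimate a<penultimate
      a⁺<2+n = s<s (<-trans a<n (n<1+n n))
      a⁺ = fromℕ< a⁺<2+n
      a⁺<final : toℕ a⁺ < suc n
      a⁺<final = subst (_< suc n) (sym (toℕ-fromℕ< a⁺<2+n)) (s<s a<n)
      z≢final : z ≢ final
      z≢final refl = x≢0 fz≡0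
      z<a : toℕ z < toℕ a
      z<a with <-cmp (toℕ z) (toℕ a)
      ... | tri< z<a _ _ = z<a
      ... | tri≈ _ z≡a _ = ⊥-elim (Nat.0≢1+n (trans (sym fz≡0) (trans (cong f (toℕ-injective z≡a)) fa≡1+x)))
      ... | tri> _ _ a<z = ⊥-elim (no-dip (z , a<z , ≢final⇒< z≢final , subst (_< x) (sym fz≡0) (n≢0⇒n>0 x≢0)))
      fa<fa⁺ : f a < f a⁺
      fa<fa⁺ = subst (_< f a⁺) (sym fa≡1+x) (≤∧≢⇒< (≤∧≢⇒< x≤fa⁺ x≢fa⁺) 1+x≢fa⁺)
        where
        a<a⁺ = subst (toℕ a <_) (sym (toℕ-fromℕ< a⁺<2+n)) (n<1+n _)
        x≤fa⁺ = ≮⇒≥ (λ fa⁺<x → no-dip (a⁺ , a<a⁺ , a⁺<final , fa⁺<x))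
        x≢fa⁺ = λ x≡fa⁺ → <-irrefl (trans (cong toℕ (sym (g-inj (toℕ-injective x≡fa⁺)))) toℕ-final) a⁺<final
        1+x≢fa⁺ = λ 1+x≡fa⁺ → <-irrefl (cong toℕ (g-inj (toℕ-injective (trans fa≡1+x 1+x≡fa⁺)))) a<a⁺

  -- The value 0 before the ascent y < x would start an occurrence of p; once y = 0, the value
  -- x + 1 before it would start an occurrence of r.
  ascending-end : y < x → y ≡ 0 × x ≡ suc n
  ascending-end y<x = y≡0 , x≡1+n
    where
    y≡0 : y ≡ 0
    y≡0 with y ≟ℕ 0
    ... | yes y≡0 = y≡0
    ... | no  y≢0 with position-of 0 z<s
    ...   | a , fa≡0 = ⊥-elim (¬p (mkP a penultimate final (before-penultimate a≢final a≢penultimate)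
                                     final≡1+penultimate (subst (_< y) (sym fa≡0) (n≢0⇒n>0 y≢0)) y<x))
      where
      a≢final : a ≢ final
      a≢final refl = Nat.n≮0 (subst (y <_) fa≡0 y<x)
      a≢penultimate : a ≢ penultimate
      a≢penultimate refl = y≢0 fa≡0
    x≡1+n : x ≡ suc n
    x≡1+n with x ≟ℕ suc n
    ... | yes x≡1+n = x≡1+n
    ... | no  x≢1+n with position-of (suc x) (s<s (≤∧≢⇒< (≤-pred (toℕ<n (g final))) x≢1+n))
    ...   | a , fa≡1+x = ⊥-elim (¬r (mkR a penultimate final (before-penultimate a≢final a≢penultimate)
                                       penultimate<final y<x fa≡1+x))
      where
      a≢final : a ≢ final
      a≢final refl = 1+n≢n (sym fa≡1+x)
      a≢penultimate : a ≢ penultimate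
      a≢penultimate refl = Nat.0≢1+n (trans (sym y≡0) fa≡1+x)

  -- Otherwise x + 1 lies before the penultimate position and, with the dip after it, forms r.
  descending-end : x ≢ 0 → x < y → y ≡ suc x
  descending-end x≢0 x<y with y ≟ℕ suc x
  ... | yes y≡1+x = y≡1+x
  ... | no  y≢1+x with position-of (suc x) (<-trans (≤∧≢⇒< x<y (y≢1+x ∘ sym)) (toℕ<n (g penultimate)))
  ...   | a , fa≡1+x with dip-after x≢0 fa≡1+x (before-penultimate a≢final a≢penultimate)
    where
    a≢final : a ≢ final
    a≢final refl = 1+n≢n (sym fa≡1+x)
    a≢penultimate : a ≢ penultimate
    a≢penultimate refl = y≢1+x fa≡1+x
  ...     | b , a<b , b<1+n , fb<x =
    ⊥-elim (¬r (mkR a b final a<b (subst (toℕ b <_) (sym toℕ-final) b<1+n) fb<x fa≡1+x))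

  avoider⇒admissibleEnding : AdmissibleEnding f
  avoider⇒admissibleEnding with x ≟ℕ 0 | <-cmp y x
  ... | yes x≡0 | _            = inj₁ x≡0
  ... | no  _   | tri< y<x _ _ = inj₂ (inj₂ (ascending-end y<x))
  ... | no  _   | tri≈ _ y≡x _ = ⊥-elim (fromℕ≢inject₁ (g-inj (toℕ-injective (sym y≡x))))
  ... | no  x≢0 | tri> _ _ x<y = inj₂ (inj₁ (descending-end x≢0 x<y))

extend : ∀ {m} → Fin (suc m) → Vec (Fin m) m → Vec (Fin (suc m)) (suc m)
extend v τ = map (punchIn v) τ ∷ʳ v

lookup-∷ʳ-final : ∀ {A : Set} {m} (xs : Vec A m) x → lookup (xs ∷ʳ x) final ≡ x
lookup-∷ʳ-final []       x = refl
lookup-∷ʳ-final (_ ∷ xs) x = lookup-∷ʳ-final xs x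

lookup-∷ʳ-inject₁ : ∀ {A : Set} {m} (xs : Vec A m) x j → lookup (xs ∷ʳ x) (inject₁ j) ≡ lookup xs j
lookup-∷ʳ-inject₁ (_ ∷ xs) x zero    = refl
lookup-∷ʳ-inject₁ (_ ∷ xs) x (suc j) = lookup-∷ʳ-inject₁ xs x j

map-injective : ∀ {A B : Set} {m} {f : A → B} → Injective _≡_ _≡_ f → Injective _≡_ _≡_ (map {n = m} f)
map-injective _     {[]}    {[]}    _  = refl
map-injective f-inj {_ ∷ _} {_ ∷ _} eq with ∷-injective eq
... | head≡ , tail≡ = cong₂ _∷_ (f-inj head≡) (map-injective f-inj tail≡)

extend-injective₂ : ∀ {m} {v v′ : Fin (suc m)} {τ τ′ : Vec (Fin m) m} →
                    extend v τ ≡ extend v′ τ′ → v ≡ v′ × τ ≡ τ′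
extend-injective₂ {v = v} {τ = τ} {τ′} eq with ∷ʳ-injective (map (punchIn v) τ) _ eq
... | prefix≡ , refl = refl , map-injective (punchIn-injective v _ _) prefix≡

punchIn-onto : ∀ {m k} (v : Fin (suc m)) (ρ : Vec (Fin (suc m)) k) → (∀ j → v ≢ lookup ρ j) →
               ∃ λ τ → map (punchIn v) τ ≡ ρ
punchIn-onto v []      _   = [] , refl
punchIn-onto v (x ∷ ρ) v∉ρ with punchIn-onto v ρ (v∉ρ ∘ suc)
... | τ , eq = punchOut (v∉ρ zero) ∷ τ , cong₂ _∷_ (punchIn-punchOut (v∉ρ zero)) eq

extend-surjective : ∀ {m} (π : Vec (Fin (suc m)) (suc m)) → Injective _≡_ _≡_ (lookup π) →
                    ∃₂ λ v τ → π ≡ extend v τ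
extend-surjective π inj with initLast π
... | ρ , v , refl with punchIn-onto v ρ v∉ρ
  where
  v∉ρ : ∀ j → v ≢ lookup ρ j
  v∉ρ j v≡ρj =
    fromℕ≢inject₁ (inj (trans (lookup-∷ʳ-final ρ v) (trans v≡ρj (sym (lookup-∷ʳ-inject₁ ρ v j)))))
...   | τ , refl = v , τ , refl

module _ {m : ℕ} (v : Fin (suc m)) (τ : Vec (Fin m) m) where

  private
    π = extend v τ

  lookup-extend-final : lookup π final ≡ v
  lookup-extend-final = lookup-∷ʳ-final (map (punchIn v) τ) v

  lookup-extend-inject₁ : ∀ j → lookup π (inject₁ j) ≡ punchIn v (lookup τ j)
  lookup-extend-inject₁ j = trans (lookup-∷ʳ-inject₁ (map (punchIn v) τ) v j) (lookup-map j (punchIn v) τ)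

  values-extend-final : values π final ≡ toℕ v
  values-extend-final = cong toℕ lookup-extend-final

  values-extend-inject₁ : ∀ j → values π (inject₁ j) ≡ punchInℕ (toℕ v) (values τ j)
  values-extend-inject₁ j = trans (cong toℕ (lookup-extend-inject₁ j)) (toℕ-punchIn v (lookup τ j))

  extend-injective : Injective _≡_ _≡_ (lookup τ) → Injective _≡_ _≡_ (lookup π)
  extend-injective τ-inj {a} {b} eq with final-or-inject₁ a | final-or-inject₁ b
  ... | inj₁ refl        | inj₁ refl        = refl
  ... | inj₁ refl        | inj₂ (b′ , refl) =
    ⊥-elim (punchInᵢ≢i v _ (sym (trans (sym lookup-extend-final) (trans eq (lookup-extend-inject₁ b′)))))
  ... | inj₂ (a′ , refl) | inj₁ refl        =
    ⊥-elim (punchInᵢ≢i v _ (trans (sym (lookup-extend-inject₁ a′)) (trans eq lookup-extend-final)))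
  ... | inj₂ (a′ , refl) | inj₂ (b′ , refl) = cong inject₁ (τ-inj (punchIn-injective v _ _
    (trans (sym (lookup-extend-inject₁ a′)) (trans eq (lookup-extend-inject₁ b′)))))

  extend-injective⁻ : Injective _≡_ _≡_ (lookup π) → Injective _≡_ _≡_ (lookup τ)
  extend-injective⁻ π-inj {a} {b} eq = inject₁-injective (π-inj
    (trans (lookup-extend-inject₁ a) (trans (cong (punchIn v) eq) (sym (lookup-extend-inject₁ b)))))

  private
    values-extend-< : ∀ {a b} → values τ a < values τ b → values π (inject₁ a) < values π (inject₁ b)
    values-extend-< {a} {b} =
      subst₂ _<_ (sym (values-extend-inject₁ a)) (sym (values-extend-inject₁ b)) ∘ punchInℕ-mono-< (toℕ v)

    values-extend-<⁻ : ∀ {a b} → values π (inject₁ a) < values π (inject₁ b) → values τ a < values τ b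
    values-extend-<⁻ {a} {b} =
      punchInℕ-cancel-< (toℕ v) ∘ subst₂ _<_ (values-extend-inject₁ a) (values-extend-inject₁ b)

    values-extend-suc⁻ : ∀ {a b} → values π (inject₁ a) ≡ suc (values π (inject₁ b)) →
                         values τ a ≡ suc (values τ b)
    values-extend-suc⁻ {a} {b} eq = punchInℕ-cancel-suc (toℕ v)
      (trans (sym (values-extend-inject₁ a)) (trans eq (cong suc (values-extend-inject₁ b))))

  P-extend : P-Occurrence (values τ) → P-Occurrence (values π)
  P-extend = P-inject₁ ∘ P-transfer values-extend-<

  P-extend⁻ : P-Occurrence (values π ∘ inject₁) → P-Occurrence (values τ)
  P-extend⁻ = P-transfer values-extend-<⁻

  R-extend⁻ : R-Occurrence (values π ∘ inject₁) → R-Occurrence (values τ)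
  R-extend⁻ = R-transfer values-extend-<⁻ values-extend-suc⁻

  -- Inserting v keeps the values at i and k adjacent unless v = values τ k + 1 falls between
  -- them; then v itself, at the final position, takes over the role of k.
  R-extend : R-Occurrence (values τ) → R-Occurrence (values π)
  R-extend (mkR i j k i<j j<k tj<tk ti≡1+tk) with punchInℕ-suc (toℕ v) (values τ k)
  ... | inj₁ adjacent = R-inject₁ (mkR i j k i<j j<k (values-extend-< tj<tk) (begin
    values π (inject₁ i)                       ≡⟨ values-extend-inject₁ i ⟩
    punchInℕ (toℕ v) (values τ i)              ≡⟨ cong (punchInℕ (toℕ v)) ti≡1+tk ⟩
    punchInℕ (toℕ v) (suc (values τ k))        ≡⟨ adjacent ⟩
    suc (punchInℕ (toℕ v) (values τ k))        ≡⟨ cong suc (values-extend-inject₁ k) ⟨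
    suc (values π (inject₁ k))                 ∎))
    where open ≡-Reasoning
  ... | inj₂ v≡1+tk =
    mkR (inject₁ i) (inject₁ j) final (inject₁⁺ _<_ i<j) (subst (toℕ (inject₁ j) <_) (sym toℕ-final) (inject₁ℕ< j))
        πj<v πi≡1+v
    where
    open ≡-Reasoning
    πj<v : values π (inject₁ j) < values π final
    πj<v = subst₂ _<_ (sym (trans (values-extend-inject₁ j) (punchInℕ-< tj<v))) (sym values-extend-final) tj<v
      where tj<v = <-trans tj<tk (≤-reflexive (sym v≡1+tk))
    πi≡1+v : values π (inject₁ i) ≡ suc (values π final)
    πi≡1+v = begin
      values π (inject₁ i)                   ≡⟨ values-extend-inject₁ i ⟩
      punchInℕ (toℕ v) (values τ i)          ≡⟨ cong (punchInℕ (toℕ v)) (trans ti≡1+tk (sym v≡1+tk)) ⟩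
      punchInℕ (toℕ v) (toℕ v)               ≡⟨ punchInℕ-≥ Nat.≤-refl ⟩
      suc (toℕ v)                            ≡⟨ cong suc values-extend-final ⟨
      suc (values π final)                   ∎

-- When the penultimate entry u is positive, appending the value u (which shifts u up to u + 1)
-- makes the penultimate value one above the last; when u = 0 the maximum is appended instead.
belowOrTop : ∀ {n} → Fin (suc n) → Fin (suc (suc n))
belowOrTop zero    = final
belowOrTop (suc u) = inject₁ (suc u)

admissible⇔ : ∀ {n} (v : Fin (suc (suc n))) (u : Fin (suc n)) →
              Admissible n (toℕ v) (punchInℕ (toℕ v) (toℕ u)) ⇔ (v ≡ zero ⊎ v ≡ belowOrTop u)
admissible⇔ {n} v u = mk⇔ (to v u) (from v u)
  where
  to : ∀ v u → Admissible n (toℕ v) (punchInℕ (toℕ v) (toℕ u)) → v ≡ zero ⊎ v ≡ belowOrTop u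
  to zero    _       _                         = inj₁ refl
  to (suc v) zero    (inj₂ (inj₂ (_ , x≡1+n))) = inj₂ (toℕ-injective (trans x≡1+n (sym toℕ-final)))
  to (suc v) (suc u) (inj₂ (inj₁ y≡1+x))       = inj₂ (cong suc (toℕ-injective
    (trans (sym (punchInℕ≡1+v (toℕ v) (Nat.suc-injective y≡1+x))) (sym (toℕ-inject₁ u)))))

  from : ∀ v u → v ≡ zero ⊎ v ≡ belowOrTop u → Admissible n (toℕ v) (punchInℕ (toℕ v) (toℕ u))
  from _ _       (inj₁ refl) = inj₁ refl
  from _ zero    (inj₂ refl) = inj₂ (inj₂ (refl , toℕ-final))
  from _ (suc u) (inj₂ refl) = inj₂ (inj₁ (cong suc
    (trans (punchInℕ-≥ (≤-reflexive (toℕ-inject₁ u))) (cong suc (sym (toℕ-inject₁ u))))))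

extend-avoider⇔ : ∀ {n} (v : Fin (suc (suc n))) (τ : Vec (Fin (suc n)) (suc n)) →
                  Avoider (extend v τ) ⇔ (Avoider τ × (v ≡ zero ⊎ v ≡ belowOrTop (lookup τ final)))
extend-avoider⇔ {n} v τ = mk⇔ to from
  where
  π = extend v τ
  Choice = v ≡ zero ⊎ v ≡ belowOrTop (lookup τ final)

  ending⇔ : AdmissibleEnding (values π) ⇔ Choice
  ending⇔ = subst₂ (λ x y → Admissible n x y ⇔ Choice) (sym (values-extend-final v τ))
                   (sym (values-extend-inject₁ v τ final)) (admissible⇔ v (lookup τ final))

  to : Avoider π → Avoider τ × Choice
  to (π-inj , ¬p , ¬r) =
    (extend-injective⁻ v τ π-inj , ¬p ∘ P-extend v τ , ¬r ∘ R-extend v τ) ,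
    Equivalence.to ending⇔ (avoider⇒admissibleEnding π-inj ¬p ¬r)

  from : Avoider τ × Choice → Avoider π
  from ((τ-inj , ¬p , ¬r) , choice) =
    π-inj ,
    ¬p ∘ P-extend⁻ v τ ∘ P-admissible ending ,
    ¬r ∘ R-extend⁻ v τ ∘ R-admissible (π-inj ∘ toℕ-injective) (toℕ<n ∘ lookup π) ending
    where
    π-inj = extend-injective v τ τ-inj
    ending = Equivalence.from ending⇔ choice

extendBelowOrTop : ∀ {n} → Vec (Fin (suc n)) (suc n) → Vec (Fin (suc (suc n))) (suc (suc n))
extendBelowOrTop τ = extend (belowOrTop (lookup τ final)) τ

avoiders : (n : ℕ) → List (Vec (Fin (suc n)) (suc n))
avoiders zero    = List.[ zero ∷ [] ]
avoiders (suc n) = List.map (extend zero) (avoiders n) ++ List.map extendBelowOrTop (avoiders n)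

avoiders-length : ∀ n → length (avoiders n) ≡ 2 ^ n
avoiders-length zero    = refl
avoiders-length (suc n) = begin
  length (List.map (extend zero) L ++ List.map extendBelowOrTop L)         ≡⟨ length-++ (List.map (extend zero) L) ⟩
  length (List.map (extend zero) L) + length (List.map extendBelowOrTop L) ≡⟨ cong₂ _+_ (length-map _ L) (length-map _ L) ⟩
  length L + length L                                                      ≡⟨ cong (λ k → k + k) (avoiders-length n) ⟩
  2 ^ n + 2 ^ n                                                            ≡⟨ cong (2 ^ n +_) (+-identityʳ (2 ^ n)) ⟨
  2 ^ suc n                                                                ∎
  where
  open ≡-Reasoning
  L = avoiders n

belowOrTop≢zero : ∀ {n} (u : Fin (suc n)) → belowOrTop u ≢ zero
belowOrTop≢zero zero    ()
belowOrTop≢zero (suc u) ()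

avoiders-unique : ∀ n → Unique (avoiders n)
avoiders-unique zero    = All.[] AllPairs.∷ AllPairs.[]
avoiders-unique (suc n) =
  Unique.++⁺ (Unique.map⁺ (proj₂ ∘ extend-injective₂) (avoiders-unique n))
             (Unique.map⁺ (proj₂ ∘ extend-injective₂) (avoiders-unique n))
             disjoint
  where
  disjoint : ∀ {π} → ¬ (π ∈ List.map (extend zero) (avoiders n) × π ∈ List.map extendBelowOrTop (avoiders n))
  disjoint (∈₀ , ∈₁) with ∈-map⁻ (extend zero) ∈₀ | ∈-map⁻ extendBelowOrTop ∈₁
  ... | τ , _ , refl | τ′ , _ , eq = belowOrTop≢zero (lookup τ′ final) (sym (proj₁ (extend-injective₂ eq)))

avoiders-complete : ∀ n (π : Vec (Fin (suc n)) (suc n)) → π ∈ avoiders n ⇔ Avoider π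
avoiders-complete zero    (zero ∷ []) = mk⇔ (λ _ → singleton-avoider) (λ _ → here refl)
  where
  singleton-avoider : Avoider (zero ∷ [])
  singleton-avoider =
    (λ { {zero} {zero} _ → refl }) , (λ { (mkP zero zero _ () _ _ _) }) , (λ { (mkR zero zero _ () _ _ _) })
avoiders-complete (suc n) π = mk⇔ member⇒avoider avoider⇒member
  where
  open Equivalence using (to; from)

  member⇒avoider : π ∈ avoiders (suc n) → Avoider π
  member⇒avoider π∈ with ∈-++⁻ (List.map (extend zero) (avoiders n)) π∈
  ... | inj₁ π∈₀ with ∈-map⁻ (extend zero) π∈₀
  ...   | τ , τ∈ , refl = from (extend-avoider⇔ zero τ) (to (avoiders-complete n τ) τ∈ , inj₁ refl)
  member⇒avoider π∈ | inj₂ π∈₁ with ∈-map⁻ extendBelowOrTop π∈₁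
  ...   | τ , τ∈ , refl = from (extend-avoider⇔ _ τ) (to (avoiders-complete n τ) τ∈ , inj₂ refl)

  avoider⇒member : Avoider π → π ∈ avoiders (suc n)
  avoider⇒member avoider with extend-surjective π (proj₁ avoider)
  ... | v , τ , refl with to (extend-avoider⇔ v τ) avoider
  ...   | τ-avoider , inj₁ refl = ∈-++⁺ˡ (∈-map⁺ (extend zero) (from (avoiders-complete n τ) τ-avoider))
  ...   | τ-avoider , inj₂ refl =
    ∈-++⁺ʳ (List.map (extend zero) (avoiders n)) (∈-map⁺ extendBelowOrTop (from (avoiders-complete n τ) τ-avoider))

proposition11 : (n : ℕ) → 1 ≤ n → HasCard (InAv₂ n p r) (2 ^ (n ∸ 1))
proposition11 zero    ()
proposition11 (suc n) _ =
  avoiders n ,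
  avoiders-unique n ,
  (λ π → ⇔.trans (avoiders-complete n π) (⇔.sym (inAv₂⇔avoider π))) ,
  avoiders-length n
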